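{- The side condition of rule $(\alpha_1)$, namely $a\in\bigcup_{i\geqslant1}FV_i(\lambda a.M)$ and $b\notin\bigcup_{i\geqslant1}FV_i(\lambda a.M)$, can equivalently be written as $a\in\bigcup_{i\geqslant1}FV_i(\lambda a.M)$ and $b\notin\bigcup_{i\geqslant1}FV_i(\lambda b.\langle\pi_b\,,\,b\backslash a\rangle\circ M)$.
   Context: $\lambda\pi$ terms $M::= a\mid MN\mid\lambda a.M\mid s\circ M$, substitutions $s::= id\mid\pi_a\mid\langle s\,,\,N\backslash a\rangle\mid s\circ q$. Rule $(\alpha_1)$: $\lambda a.M\rightarrow\lambda b.\langle\pi_b\,,\,b\backslash a\rangle\circ M$. $FV(M)=\langle FV_1(M),FV_2(M),\ldots\rangle$: $FV(a)=\langle\{a\},\emptyset,\ldots\rangle$, $FV(MN)=FV(M)\cup FV(N)$, $FV(\lambda a.M)=O_{\lambda a}(FV(M))$, $FV(s\circ M)=O_s(FV(M))$, with $O_{\lambda a}(\mathcal A)=\langle(\mathcal A_1\setminus\{a\})\cup\mathcal A_2,\mathcal A_3,\ldots\rangle$, $O_{id}(\mathcal A)=\mathcal A$, $O_{\pi_a}(\mathcal A)=\langle\emptyset,\mathcal A_1,\mathcal A_2,\ldots\rangle$, $O_{s\circ q}=O_s\circ O_q$, $O_{\langle s,N\backslash a\rangle}(\mathcal A)=O_s(O_{\lambda a}(\mathcal A))\cup FV(N)$. -}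

module Defs where

open import Data.Nat using (ℕ; zero; suc)
open import Data.Product using (_×_; ∃)
open import Data.Sum using (_⊎_)
open import Data.Empty using (⊥)
open import Relation.Nullary using (¬_)
open import Relation.Binary.PropositionalEquality using (_≡_; _≢_)

Name : Set
Name = ℕ

mutual
  -- Terms  M ::= a | M N | λ a . M | s ∘ M
  data Term : Set where
    var  : Name → Term
    app  : Term → Term → Term
    lam  : Name → Term → Term
    sub  : Subst → Term → Term

  -- Substitutions  s ::= id | π_a | ⟨ s , N \ a ⟩ | s ∘ q
  data Subst : Set where
    idS  : Subst
    π    : Name → Subst
    ext  : Subst → Term → Name → Subst   -- ext s N a  =  ⟨ s , N \ a ⟩
    comp : Subst → Subst → Subst

-- A sequence of sets of names ⟨ A₁ , A₂ , … ⟩.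
-- Convention: index i : ℕ stands for A_{i+1} (so index 0 is A₁).
NameSeq : Set₁
NameSeq = ℕ → Name → Set

∅ : Name → Set
∅ _ = ⊥

_∪_ : NameSeq → NameSeq → NameSeq
(A ∪ B) i x = A i x ⊎ B i x

-- O_{λa}(A) = ⟨ (A₁ ∖ {a}) ∪ A₂ , A₃ , … ⟩
Oλ : Name → NameSeq → NameSeq
Oλ a A zero    x = (A 0 x × x ≢ a) ⊎ A 1 x
Oλ a A (suc i) x = A (suc (suc i)) x

Oπ : NameSeq → NameSeq
Oπ A zero    = ∅
Oπ A (suc i) = A i

mutual
  FV : Term → NameSeq
  FV (var a)   zero    x = x ≡ a
  FV (var a)   (suc i) x = ⊥
  FV (app M N)           = FV M ∪ FV N
  FV (lam a M)           = Oλ a (FV M)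
  FV (sub s M)           = O s (FV M)

  O : Subst → NameSeq → NameSeq
  O idS        A = A
  O (π a)      A = Oπ A
  O (comp s q) A = O s (O q A)
  O (ext s N a) A = O s (Oλ a A) ∪ FV N

_∈FV_ : Name → Term → Set
x ∈FV M = ∃ λ i → FV M i x

α₁-rhs : Name → Name → Term → Term
α₁-rhs a b M = lam b (sub (ext (π b) (var b) a) M)

module Submission where

-- The proof rests on a stronger fact: the two terms have, level by
-- level, exactly the same free variables.  Unfolding FV, the only
-- place where the reduct differs from λa.M is at level 1, where the
-- substitution ⟨π_b , b\a⟩ contributes the name b; but this occurrence
-- is immediately removed again by the outer binder λb (its level-1
-- part is FV₁ ∖ {b}).  Everything else is just shifted by π_b and
-- shifted back by λb.

open import Defs
open import Data.Nat using (ℕ; zero; suc)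
open import Data.Product using (_×_; _,_; ∃)
open import Data.Product.Function.NonDependent.Propositional using (_×-⇔_)
open import Data.Sum using (inj₁; inj₂)
open import Relation.Nullary using (¬_)
open import Function.Bundles using (_⇔_; mk⇔; Equivalence)
open import Function.Construct.Identity using (⇔-id)
open import Function.Related.TypeIsomorphisms using (¬-cong-⇔)

FV-α₁-rhs : (a b : Name) (M : Term) (i : ℕ) (x : Name) →
  FV (lam a M) i x ⇔ FV (α₁-rhs a b M) i x
FV-α₁-rhs a b M zero    x = mk⇔ to from
  where
    to : FV (lam a M) zero x → FV (α₁-rhs a b M) zero x
    to p = inj₂ (inj₁ p)

    -- level 1 of the reduct: (FV₁(⟨π_b , b\a⟩∘M) ∖ {b}) ∪ FV₂(⟨π_b , b\a⟩∘M),
    -- where FV₁(⟨π_b , b\a⟩∘M) = ∅ ∪ {b} and FV₂(⟨π_b , b\a⟩∘M) = FV₁(λa.M) ∪ ∅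
    from : FV (α₁-rhs a b M) zero x → FV (lam a M) zero x
    from (inj₁ (inj₁ () , _))
    from (inj₁ (inj₂ x≡b , x≢b)) with () ← x≢b x≡b
    from (inj₂ (inj₁ p))      = p
    from (inj₂ (inj₂ ()))
FV-α₁-rhs a b M (suc i) x = mk⇔ inj₁ from
  where
    from : FV (α₁-rhs a b M) (suc i) x → FV (lam a M) (suc i) x
    from (inj₁ p) = p
    from (inj₂ ())

⋃-cong : {A B : NameSeq} {x : Name} →
  (∀ i → A i x ⇔ B i x) → (∃ λ i → A i x) ⇔ (∃ λ i → B i x)
⋃-cong A⇔B = mk⇔ (λ (i , p) → i , Equivalence.to (A⇔B i) p)
                 (λ (i , p) → i , Equivalence.from (A⇔B i) p)

∈FV-α₁-rhs : (a b : Name) (M : Term) (x : Name) →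
  x ∈FV lam a M ⇔ x ∈FV α₁-rhs a b M
∈FV-α₁-rhs a b M x =
  ⋃-cong {FV (lam a M)} {FV (α₁-rhs a b M)} (λ i → FV-α₁-rhs a b M i x)

mainTheorem17 : (a b : Name) (M : Term) →
    ((a ∈FV lam a M) × ¬ (b ∈FV lam a M))
    ⇔ ((a ∈FV lam a M) × ¬ (b ∈FV α₁-rhs a b M))
mainTheorem17 a b M =
  ⇔-id _ ×-⇔ ¬-cong-⇔ (∈FV-α₁-rhs a b M b)
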